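{- Let $H$ be a marked hypergraph with $|V(H)\setminus M(H)|\ge2$. For each $x\in V(H)\setminus M(H)$, let $\mathcal X_x$ be the collection of all dangers at $x$ in $H$. Then $H$ is a Breaker win if and only if for every $x\in V(H)\setminus M(H)$ we have $\mathrm{Int}_{H^{+x}}(\mathcal X_x)\neq\varnothing$.
   Context: A marked hypergraph $H$: finite nonempty $V(H)$, edge set $E(H)$ of nonempty subsets of $V(H)$, marked set $M(H)\subseteq V(H)$. Subhypergraph $X$: $V(X)\subseteq V(H)$, $E(X)\subseteq E(H)$, $M(X)=V(X)\cap M(H)$. $H^{+x}$ marks non-marked $x$; $H^{ -y}$ deletes $y$ and all edges containing it. Trivial Maker win: some edge $e$ with $|e\setminus M(H)|\le1$. Maker win (recursive): if $|V(H)\setminus M(H)|\le1$, iff trivial Maker win; otherwise iff some non-marked $x$ has $H^{+x-y}$ a Maker win for all non-marked $y\ne x$; otherwise Breaker win. A danger at $x$ in $H$ is a subhypergraph $D$ of $H$ containing $x$ such that $D^{+x}$ is a Maker win. For a collection $\mathcal X$ of subhypergraphs, $\mathrm{Int}_{H^{+x}}(\mathcal X)$ is the set of vertices $y\in V(H)\setminus(M(H)\cup\{x\})$ with $y\in V(X)$ for all $X\in\mathcal X$. -}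

module Defs where

open import Data.Nat using (ℕ; _≤_; _≥_)
open import Data.Fin using (Fin)
open import Data.Fin.Subset using (Subset; _∈_; _∉_; _⊆_; _∩_; _∪_; _─_; _-_; ⁅_⁆; ∣_∣; Nonempty)
open import Data.Fin.Subset.Properties using (_∈?_)
open import Data.List using (List; filter)
open import Data.List.Relation.Unary.All using (All)
open import Data.List.Relation.Unary.Any using (Any)
import Data.List.Membership.Propositional as LM
open import Data.Product using (Σ; ∃; _×_)
open import Relation.Binary.PropositionalEquality using (_≡_)
open import Relation.Nullary using (¬_; ¬?)

record MHG (n : ℕ) : Set where
  constructor mhg
  field
    V : Subset n
    E : List (Subset n)
    M : Subset n
open MHG public

record WF {n : ℕ} (H : MHG n) : Set where
  field
    V-nonempty : Nonempty (V H)
    E-nonempty : All Nonempty (E H)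
    E-⊆V       : All (_⊆ V H) (E H)
    M-⊆V       : M H ⊆ V H

Free : {n : ℕ} → MHG n → Subset n
Free H = V H ─ M H

mark : {n : ℕ} → MHG n → Fin n → MHG n
mark H x = mhg (V H) (E H) (M H ∪ ⁅ x ⁆)

delete : {n : ℕ} → MHG n → Fin n → MHG n
delete H y = mhg (V H - y) (filter (λ e → ¬? (y ∈? e)) (E H)) (M H - y)

TrivialMakerWin : {n : ℕ} → MHG n → Set
TrivialMakerWin H = Any (λ e → ∣ e ─ M H ∣ ≤ 1) (E H)

-- Maker win, as the (well-founded) recursive definition given inductively.
data MakerWin {n : ℕ} (H : MHG n) : Set where
  base : ∣ Free H ∣ ≤ 1 → TrivialMakerWin H → MakerWin H
  step : ∣ Free H ∣ ≥ 2 → (x : Fin n) → x ∈ Free H →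
         ((y : Fin n) → y ∈ Free H → ¬ (y ≡ x) → MakerWin (delete (mark H x) y)) →
         MakerWin H

BreakerWin : {n : ℕ} → MHG n → Set
BreakerWin H = ¬ MakerWin H

record Sub {n : ℕ} (X H : MHG n) : Set where
  field
    wf   : WF X
    V⊆   : V X ⊆ V H
    E⊆   : All (LM._∈ E H) (E X)
    Meq  : M X ≡ V X ∩ M H

record Danger {n : ℕ} (H : MHG n) (x : Fin n) (D : MHG n) : Set where
  field
    sub   : Sub D H
    x∈D   : x ∈ V D
    win   : MakerWin (mark D x)

-- y ∈ Int_{H^{+x}}(X_x), with X_x = all dangers at x in H
InInt : {n : ℕ} → MHG n → Fin n → Fin n → Set
InInt {n} H x y = y ∈ V H × y ∉ M H × ¬ (y ≡ x) ×
  ((D : MHG n) → Danger H x D → y ∈ V D)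

-- If Maker wins by marking x first, then for every vertex y of Int the
-- hypergraph H^{-y} is a danger at x, because Maker's winning strategy
-- answers the reply y; it does not contain y, so Int is empty.
-- Conversely, if Breaker wins (a decidable property), every first mark x has
-- a reply y leaving a Breaker win H^{+x-y}. A danger D at x avoiding y would
-- contradict this: Maker's win on D^{+x} transfers to every position H′ with
-- D^{+x} ≼ H′, i.e. H′ has at least the free vertices of D^{+x} and shadows
-- each of its edges by an edge with fewer free vertices; H^{+x-y} is such an H′.
module Submission where

open import Defs
open import Data.Nat using (ℕ; _≥_; _≤_; _<_; _≤?_; s≤s; z≤n)
open import Data.Nat.Properties using (≤-trans; <-≤-trans; <⇒≱; ≰⇒>)
open import Data.Nat.Induction using (<-wellFounded)
open import Data.Fin using (Fin; _≟_)
import Data.Fin.Properties as Fin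
open import Data.Fin.Subset
  using (Subset; inside; outside; _∈_; _∉_; _⊆_; _∩_; _∪_; _─_; _-_; ⁅_⁆; ∣_∣; Nonempty)
open import Data.Fin.Subset.Properties
  using ( _∈?_; nonempty?; Empty-unique; ∣⊥∣≡0; ∣⁅x⁆∣≡1; x∈⁅x⁆; x∈⁅y⁆⇒x≡y
        ; x∈p∪q⁺; x∈p∪q⁻; x∈p∩q⁺; x∈p∩q⁻; x∈p∧x∉q⇒x∈p─q; x∈p∧x≢y⇒x∈p-y
        ; p─q⊆p; ⊆-trans; ⊆-antisym; p⊆q⇒∣p∣≤∣q∣; p⊂q⇒∣p∣<∣q∣
        ; x∈p⇒∣p-x∣<∣p∣ )
open import Data.Vec.Base using (_∷_; here; there)
import Data.List.Membership.Propositional as List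
open import Data.List.Membership.Propositional.Properties using (∈-filter⁺; ∈-filter⁻)
import Data.List.Relation.Unary.All as All
import Data.List.Relation.Unary.Any as Any
open import Data.Product using (∃; _×_; _,_; proj₁; proj₂)
open import Data.Sum using (inj₁; inj₂)
open import Function using (_∘_)
open import Function.Bundles using (_⇔_; mk⇔)
open import Induction.WellFounded using (Acc; acc)
open import Relation.Nullary using (¬_; Dec; yes; no; ¬?; contradiction)
open import Relation.Nullary.Decidable using (map′; _×-dec_; _→-dec_; decidable-stable)
open import Relation.Binary.PropositionalEquality using (_≡_; _≢_; refl; sym; trans; subst; cong)

private
  variable
    n : ℕ
    p q e : Subset n
    w x y z : Fin n
    D H X : MHG n

x∈p─q⇒x∉q : ∀ (p q : Subset n) → x ∈ p ─ q → x ∉ q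
x∈p─q⇒x∉q (_ ∷ p) (inside  ∷ q) ()          here
x∈p─q⇒x∉q (_ ∷ p) (outside ∷ q) here        ()
x∈p─q⇒x∉q (_ ∷ p) (_       ∷ q) (there x∈) (there x∈q) = x∈p─q⇒x∉q p q x∈ x∈q

x∈p─q⁻ : x ∈ p ─ q → x ∈ p × x ∉ q
x∈p─q⁻ {p = p} {q = q} x∈ = p─q⊆p p q x∈ , x∈p─q⇒x∉q p q x∈

x∈p-y⁻ : x ∈ p - y → x ∈ p × x ≢ y
x∈p-y⁻ {y = y} x∈ with x∈p─q⁻ x∈
... | x∈p , x∉⁅y⁆ = x∈p , λ x≡y → x∉⁅y⁆ (subst (_∈ ⁅ y ⁆) (sym x≡y) (x∈⁅x⁆ y))

x∉p∪⁅y⁆⁻ : x ∉ p ∪ ⁅ y ⁆ → x ∉ p × x ≢ y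
x∉p∪⁅y⁆⁻ {y = y} x∉ =
  (λ x∈p → x∉ (x∈p∪q⁺ (inj₁ x∈p))) ,
  (λ x≡y → x∉ (x∈p∪q⁺ (inj₂ (subst (_∈ ⁅ y ⁆) (sym x≡y) (x∈⁅x⁆ y)))))

x∉p∪⁅y⁆⁺ : x ∉ p → x ≢ y → x ∉ p ∪ ⁅ y ⁆
x∉p∪⁅y⁆⁺ {p = p} {y = y} x∉p x≢y x∈ with x∈p∪q⁻ p ⁅ y ⁆ x∈
... | inj₁ x∈p = x∉p x∈p
... | inj₂ x∈⁅y⁆ = x≢y (x∈⁅y⁆⇒x≡y y x∈⁅y⁆)

x∉p-y⇒x∉p : x ∉ p - y → x ≢ y → x ∉ p
x∉p-y⇒x∉p x∉ x≢y x∈p = x∉ (x∈p∧x≢y⇒x∈p-y x∈p x≢y)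

x∉p⇒x∉p-y : x ∉ p → x ∉ p - y
x∉p⇒x∉p-y x∉p = x∉p ∘ proj₁ ∘ x∈p-y⁻

p-y∪⁅x⁆≡p∪⁅x⁆-y : x ≢ y → (p - y) ∪ ⁅ x ⁆ ≡ (p ∪ ⁅ x ⁆) - y
p-y∪⁅x⁆≡p∪⁅x⁆-y {x = x} {y = y} {p = p} x≢y = ⊆-antisym l⊆r r⊆l
  where
  l⊆r : (p - y) ∪ ⁅ x ⁆ ⊆ (p ∪ ⁅ x ⁆) - y
  l⊆r w∈ with x∈p∪q⁻ (p - y) ⁅ x ⁆ w∈
  ... | inj₁ w∈p-y = let w∈p , w≢y = x∈p-y⁻ w∈p-y in
                     x∈p∧x≢y⇒x∈p-y (x∈p∪q⁺ (inj₁ w∈p)) w≢y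
  ... | inj₂ w∈⁅x⁆ = x∈p∧x≢y⇒x∈p-y (x∈p∪q⁺ (inj₂ w∈⁅x⁆))
                       (x≢y ∘ trans (sym (x∈⁅y⁆⇒x≡y x w∈⁅x⁆)))
  r⊆l : (p ∪ ⁅ x ⁆) - y ⊆ (p - y) ∪ ⁅ x ⁆
  r⊆l w∈ with x∈p-y⁻ w∈
  ... | w∈p∪⁅x⁆ , w≢y with x∈p∪q⁻ p ⁅ x ⁆ w∈p∪⁅x⁆
  ...   | inj₁ w∈p = x∈p∪q⁺ (inj₁ (x∈p∧x≢y⇒x∈p-y w∈p w≢y))
  ...   | inj₂ w∈⁅x⁆ = x∈p∪q⁺ (inj₂ w∈⁅x⁆)

p⊆q⇒p-y≡q-y∩p : p ⊆ q → p - y ≡ (q - y) ∩ p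
p⊆q⇒p-y≡q-y∩p {p = p} {q = q} {y = y} p⊆q = ⊆-antisym l⊆r r⊆l
  where
  l⊆r : p - y ⊆ (q - y) ∩ p
  l⊆r w∈ = let w∈p , w≢y = x∈p-y⁻ w∈ in x∈p∩q⁺ (x∈p∧x≢y⇒x∈p-y (p⊆q w∈p) w≢y , w∈p)
  r⊆l : (q - y) ∩ p ⊆ p - y
  r⊆l w∈ = let w∈q-y , w∈p = x∈p∩q⁻ (q - y) p w∈ in
         x∈p∧x≢y⇒x∈p-y w∈p (proj₂ (x∈p-y⁻ w∈q-y))

x∈p⇒1≤∣p∣ : x ∈ p → 1 ≤ ∣ p ∣
x∈p⇒1≤∣p∣ {x = x} {p = p} x∈p =
  subst (_≤ ∣ p ∣) (∣⁅x⁆∣≡1 x) (p⊆q⇒∣p∣≤∣q∣ λ w∈⁅x⁆ → subst (_∈ p) (sym (x∈⁅y⁆⇒x≡y x w∈⁅x⁆)) x∈p)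

1≤∣p∣⇒Nonempty : ∀ {n} {p : Subset n} → 1 ≤ ∣ p ∣ → Nonempty p
1≤∣p∣⇒Nonempty {n} {p} 1≤∣p∣ with nonempty? p
... | yes p≢∅ = p≢∅
... | no p≡∅ with () ← subst (1 ≤_) (∣⊥∣≡0 n) (subst (λ r → 1 ≤ ∣ r ∣) (Empty-unique p≡∅) 1≤∣p∣)

∣p∣≤1⇒x≡y : ∣ p ∣ ≤ 1 → x ∈ p → y ∈ p → x ≡ y
∣p∣≤1⇒x≡y {p = p} {x = x} {y = y} ∣p∣≤1 x∈p y∈p with x ≟ y
... | yes x≡y = x≡y
... | no x≢y = contradiction ∣p∣≤1 (<⇒≱ (<-≤-trans (s≤s 1≤∣p-x∣) (x∈p⇒∣p-x∣<∣p∣ x∈p)))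
  where
  1≤∣p-x∣ : 1 ≤ ∣ p - x ∣
  1≤∣p-x∣ = x∈p⇒1≤∣p∣ (x∈p∧x≢y⇒x∈p-y y∈p (x≢y ∘ sym))

2≤∣p∣⇒∃≢ : 2 ≤ ∣ p ∣ → x ∈ p → ∃ λ y → y ∈ p × y ≢ x
2≤∣p∣⇒∃≢ {p = p} {x = x} 2≤∣p∣ x∈p with Fin.any? (λ y → y ∈? p ×-dec ¬? (y ≟ x))
... | yes other = other
... | no ¬other = contradiction (subst (∣ p ∣ ≤_) (∣⁅x⁆∣≡1 x) (p⊆q⇒∣p∣≤∣q∣ p⊆⁅x⁆)) (<⇒≱ 2≤∣p∣)
  where
  p⊆⁅x⁆ : p ⊆ ⁅ x ⁆
  p⊆⁅x⁆ {w} w∈p with w ≟ x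
  ... | yes w≡x = subst (_∈ ⁅ x ⁆) (sym w≡x) (x∈⁅x⁆ x)
  ... | no w≢x = contradiction (w , w∈p , w≢x) ¬other

∣p∣≤1⇒⊆⁅x⁆ : ∣ p ∣ ≤ 1 → p ⊆ q → Nonempty q → ∃ λ x → x ∈ q × p ⊆ ⁅ x ⁆
∣p∣≤1⇒⊆⁅x⁆ {p = p} ∣p∣≤1 p⊆q (x₀ , x₀∈q) with nonempty? p
... | yes (x , x∈p) = x , p⊆q x∈p ,
      λ w∈p → subst (_∈ ⁅ x ⁆) (sym (∣p∣≤1⇒x≡y ∣p∣≤1 w∈p x∈p)) (x∈⁅x⁆ x)
... | no p≡∅ = x₀ , x₀∈q , λ w∈p → contradiction (_ , w∈p) p≡∅

x∈p∧y∉p⇒x≢y : x ∈ p → y ∉ p → x ≢ y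
x∈p∧y∉p⇒x≢y {p = p} x∈p y∉p x≡y = y∉p (subst (_∈ p) x≡y x∈p)

round : MHG n → Fin n → Fin n → MHG n
round H x y = delete (mark H x) y

WinningMark : MHG n → Fin n → Set
WinningMark H x = ∀ y → y ∈ Free H → y ≢ x → MakerWin (round H x y)

∈-free-round⁻ : w ∈ Free (round H x y) → w ∈ Free H × w ≢ x × w ≢ y
∈-free-round⁻ w∈ with x∈p─q⁻ w∈
... | w∈V-y , w∉M′ with x∈p-y⁻ w∈V-y
...   | w∈V , w≢y with x∉p∪⁅y⁆⁻ (x∉p-y⇒x∉p w∉M′ w≢y)
...     | w∉M , w≢x = x∈p∧x∉q⇒x∈p─q w∈V w∉M , w≢x , w≢y

∈-free-round⁺ : w ∈ Free H → w ≢ x → w ≢ y → w ∈ Free (round H x y)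
∈-free-round⁺ w∈ w≢x w≢y with x∈p─q⁻ w∈
... | w∈V , w∉M = x∈p∧x∉q⇒x∈p─q (x∈p∧x≢y⇒x∈p-y w∈V w≢y) (x∉p⇒x∉p-y (x∉p∪⁅y⁆⁺ w∉M w≢x))

∣free-round∣<∣free∣ : x ∈ Free H → ∣ Free (round H x y) ∣ < ∣ Free H ∣
∣free-round∣<∣free∣ {x = x} {H = H} {y = y} x∈ =
  p⊂q⇒∣p∣<∣q∣ (proj₁ ∘ free⁻ , x , x∈ , λ x∈′ → proj₁ (proj₂ (free⁻ x∈′)) refl)
  where
  free⁻ : ∀ {w} → w ∈ Free (round H x y) → w ∈ Free H × w ≢ x × w ≢ y
  free⁻ = ∈-free-round⁻ {H = H}

∈-edges-delete⁺ : e List.∈ E H → y ∉ e → e List.∈ E (delete H y)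
∈-edges-delete⁺ {y = y} = ∈-filter⁺ (λ e → ¬? (y ∈? e))

∈-edges-delete⁻ : ∀ (H : MHG n) → e List.∈ E (delete H y) → e List.∈ E H × y ∉ e
∈-edges-delete⁻ {y = y} H = ∈-filter⁻ (λ e → ¬? (y ∈? e)) {xs = E H}

∈-edge-free-round⁻ : y ∉ e → w ∈ e ─ M (round H x y) → w ∈ e ─ M H × w ≢ x
∈-edge-free-round⁻ y∉e w∈ with x∈p─q⁻ w∈
... | w∈e , w∉M′ with x∉p∪⁅y⁆⁻ (x∉p-y⇒x∉p w∉M′ (x∈p∧y∉p⇒x≢y w∈e y∉e))
...   | w∉M , w≢x = x∈p∧x∉q⇒x∈p─q w∈e w∉M , w≢x

∈-edge-free-round⁺ : w ∈ e ─ M H → w ≢ x → w ∈ e ─ M (round H x y)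
∈-edge-free-round⁺ w∈ w≢x with x∈p─q⁻ w∈
... | w∈e , w∉M = x∈p∧x∉q⇒x∈p─q w∈e (x∉p⇒x∉p-y (x∉p∪⁅y⁆⁺ w∉M w≢x))

-- Maker marks the only free vertex of the edge (or any vertex if it has none);
-- Breaker cannot delete the edge, and its free part does not grow.
smallEdge⇒makerWin : e List.∈ E H → ∣ e ─ M H ∣ ≤ 1 → e ─ M H ⊆ Free H → MakerWin H
smallEdge⇒makerWin {H = H} = go H (<-wellFounded _)
  where
  go : ∀ {n} {e : Subset n} (H : MHG n) → Acc _<_ ∣ Free H ∣ →
       e List.∈ E H → ∣ e ─ M H ∣ ≤ 1 → e ─ M H ⊆ Free H → MakerWin H
  go {e = e} H (acc rec) e∈ small e⊆ with ∣ Free H ∣ ≤? 1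
  ... | yes ≤1 = base ≤1 (List.lose e∈ small)
  ... | no ≰1 with ∣p∣≤1⇒⊆⁅x⁆ small e⊆ (1≤∣p∣⇒Nonempty (≤-trans (s≤s z≤n) (≰⇒> ≰1)))
  ...   | x , x∈ , e⊆⁅x⁆ = step (≰⇒> ≰1) x x∈ reply
    where
    reply : WinningMark H x
    reply y y∈ y≢x = go (round H x y) (rec (∣free-round∣<∣free∣ {H = H} x∈))
                        (∈-edges-delete⁺ {H = mark H x} e∈ y∉e)
                        (≤-trans (p⊆q⇒∣p∣≤∣q∣ shrinks) small) e⊆′
      where
      y∉e : y ∉ e
      y∉e y∈e = y≢x (x∈⁅y⁆⇒x≡y x (e⊆⁅x⁆ (x∈p∧x∉q⇒x∈p─q y∈e (proj₂ (x∈p─q⁻ y∈)))))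
      shrinks : e ─ M (round H x y) ⊆ e ─ M H
      shrinks = proj₁ ∘ ∈-edge-free-round⁻ {H = H} y∉e
      e⊆′ : e ─ M (round H x y) ⊆ Free (round H x y)
      e⊆′ w∈ with ∈-edge-free-round⁻ {H = H} y∉e w∈
      ... | w∈e─M , w≢x = ∈-free-round⁺ {H = H} {x = x} {y = y} (e⊆ w∈e─M) w≢x
                              (x∈p∧y∉p⇒x≢y (proj₁ (x∈p─q⁻ w∈e─M)) y∉e)

record _≼_ (X H : MHG n) : Set where
  field
    free⊆  : Free X ⊆ Free H
    shadow : ∀ {e} → e List.∈ E X →
             ∃ λ e′ → e′ List.∈ E H × e′ ─ M H ⊆ e ─ M X × e′ ─ M H ⊆ Free X

≼-round : X ≼ H → y ∈ Free H → (y ∈ Free X → y ≡ z) → round X x z ≼ round H x y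
≼-round {X = X} {H = H} {y = y} {z = z} {x = x} X≼H y∈ y∈X⇒y≡z =
  record { free⊆ = free⊆′ ; shadow = shadow′ }
  where
  open _≼_ X≼H
  free⊆′ : Free (round X x z) ⊆ Free (round H x y)
  free⊆′ w∈ with ∈-free-round⁻ {H = X} w∈
  ... | w∈X , w≢x , w≢z = ∈-free-round⁺ {H = H} (free⊆ w∈X) w≢x
    λ w≡y → w≢z (trans w≡y (y∈X⇒y≡z (subst (_∈ Free X) w≡y w∈X)))
  shadow′ : ∀ {e} → e List.∈ E (round X x z) → ∃ λ e′ → e′ List.∈ E (round H x y) ×
            e′ ─ M (round H x y) ⊆ e ─ M (round X x z) × e′ ─ M (round H x y) ⊆ Free (round X x z)
  shadow′ {e} e∈ with ∈-edges-delete⁻ (mark X x) e∈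
  ... | e∈X , z∉e with shadow e∈X
  ... | e′ , e′∈ , e′⊆e , e′⊆free =
    e′ , ∈-edges-delete⁺ {H = mark H x} e′∈ y∉e′ , ⊆e , ⊆free
    where
    y∉e′ : y ∉ e′
    y∉e′ y∈e′ = z∉e (subst (_∈ e) (y∈X⇒y≡z (e′⊆free y∈e′─M)) (proj₁ (x∈p─q⁻ (e′⊆e y∈e′─M))))
      where
      y∈e′─M : y ∈ e′ ─ M H
      y∈e′─M = x∈p∧x∉q⇒x∈p─q y∈e′ (proj₂ (x∈p─q⁻ y∈))
    ⊆e : e′ ─ M (round H x y) ⊆ e ─ M (round X x z)
    ⊆e w∈ with ∈-edge-free-round⁻ {H = H} y∉e′ w∈
    ... | w∈e′─M , w≢x = ∈-edge-free-round⁺ {H = X} (e′⊆e w∈e′─M) w≢x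
    ⊆free : e′ ─ M (round H x y) ⊆ Free (round X x z)
    ⊆free w∈ with ∈-edge-free-round⁻ {H = H} y∉e′ w∈
    ... | w∈e′─M , w≢x = ∈-free-round⁺ {H = X} (e′⊆free w∈e′─M) w≢x
                           (x∈p∧y∉p⇒x≢y (proj₁ (x∈p─q⁻ (e′⊆e w∈e′─M))) z∉e)

-- Breaker's reply y in H is mirrored in X by y itself when y is free in X,
-- and otherwise by an arbitrary free vertex of X other than x.
makerWin-mono : X ≼ H → MakerWin X → MakerWin H
makerWin-mono X≼H (base _ trivial) with List.find trivial
... | e , e∈ , small with _≼_.shadow X≼H e∈
...   | e′ , e′∈ , e′⊆e , e′⊆free =
  smallEdge⇒makerWin e′∈ (≤-trans (p⊆q⇒∣p∣≤∣q∣ e′⊆e) small) (⊆-trans e′⊆free (_≼_.free⊆ X≼H))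
makerWin-mono {X = X} {H = H} X≼H (step 2≤∣free∣ x x∈ wins) =
  step (≤-trans 2≤∣free∣ (p⊆q⇒∣p∣≤∣q∣ free⊆)) x (free⊆ x∈) reply
  where
  open _≼_ X≼H
  reply : WinningMark H x
  reply y y∈ y≢x with y ∈? Free X
  ... | yes y∈X = makerWin-mono (≼-round X≼H y∈ λ _ → refl) (wins y y∈X y≢x)
  ... | no y∉X with 2≤∣p∣⇒∃≢ 2≤∣free∣ x∈
  ...   | z , z∈ , z≢x =
    makerWin-mono (≼-round X≼H y∈ (λ y∈X → contradiction y∈X y∉X)) (wins z z∈ z≢x)

makerWin? : (H : MHG n) → Dec (MakerWin H)
makerWin? H = go H (<-wellFounded _)
  where
  go : ∀ {n} (H : MHG n) → Acc _<_ ∣ Free H ∣ → Dec (MakerWin H)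
  go H (acc rec) with ∣ Free H ∣ ≤? 1
  ... | yes ≤1 = map′ (base ≤1) trivial (Any.any? (λ e → ∣ e ─ M H ∣ ≤? 1) (E H))
    where
    trivial : MakerWin H → TrivialMakerWin H
    trivial (base _ t) = t
    trivial (step 2≤ _ _ _) = contradiction ≤1 (<⇒≱ 2≤)
  ... | no ≰1 = map′ (λ (x , x∈ , wins) → step (≰⇒> ≰1) x x∈ wins) winningMark
                     (Fin.any? winningMark?)
    where
    winningMark : MakerWin H → ∃ λ x → x ∈ Free H × WinningMark H x
    winningMark (base ≤1 _) = contradiction ≤1 ≰1
    winningMark (step _ x x∈ wins) = x , x∈ , wins
    winningMark? : ∀ x → Dec (x ∈ Free H × WinningMark H x)
    winningMark? x with x ∈? Free H
    ... | no x∉ = no (x∉ ∘ proj₁)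
    ... | yes x∈ = map′ (x∈ ,_) proj₂ (Fin.all? λ y →
          y ∈? Free H →-dec ¬? (y ≟ x) →-dec go (round H x y) (rec (∣free-round∣<∣free∣ {H = H} x∈)))

breakerReply : ¬ WinningMark H x → ∃ λ y → y ∈ Free H × y ≢ x × BreakerWin (round H x y)
breakerReply {H = H} {x = x} ¬wins
  with Fin.any? (λ y → y ∈? Free H ×-dec ¬? (y ≟ x) ×-dec ¬? (makerWin? (round H x y)))
... | yes reply = reply
... | no ¬reply = contradiction wins ¬wins
  where
  wins : WinningMark H x
  wins y y∈ y≢x = decidable-stable (makerWin? _) λ lose → ¬reply (y , y∈ , y≢x , lose)

Sub⇒M⊆ : Sub X H → M X ⊆ M H
Sub⇒M⊆ {X = X} {H = H} sub w∈ = proj₂ (x∈p∩q⁻ (V X) (M H) (subst (_ ∈_) (Sub.Meq sub) w∈))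

Sub⇒Free⊆ : Sub X H → Free X ⊆ Free H
Sub⇒Free⊆ sub w∈ with x∈p─q⁻ w∈
... | w∈V , w∉M = x∈p∧x∉q⇒x∈p─q (Sub.V⊆ sub w∈V)
  λ w∈MH → w∉M (subst (_ ∈_) (sym (Sub.Meq sub)) (x∈p∩q⁺ (w∈V , w∈MH)))

danger-≼ : Danger H x D → y ∉ V D → mark D x ≼ round H x y
danger-≼ {H = H} {x = x} {D = D} {y = y} danger y∉D = record { free⊆ = free⊆ ; shadow = shadow }
  where
  open Danger danger
  free⊆ : Free (mark D x) ⊆ Free (round H x y)
  free⊆ w∈ with x∈p─q⁻ w∈
  ... | w∈V , w∉M′ with x∉p∪⁅y⁆⁻ w∉M′
  ...   | w∉M , w≢x = ∈-free-round⁺ {H = H} (Sub⇒Free⊆ sub (x∈p∧x∉q⇒x∈p─q w∈V w∉M)) w≢x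
                        (x∈p∧y∉p⇒x≢y w∈V y∉D)
  shadow : ∀ {e} → e List.∈ E (mark D x) → ∃ λ e′ → e′ List.∈ E (round H x y) ×
           e′ ─ M (round H x y) ⊆ e ─ M (mark D x) × e′ ─ M (round H x y) ⊆ Free (mark D x)
  shadow {e} e∈ = e , ∈-edges-delete⁺ {H = mark H x} (All.lookup (Sub.E⊆ sub) e∈) y∉e ,
                  (λ w∈ → x∈p∧x∉q⇒x∈p─q (w∈e w∈) (w∉M w∈)) ,
                  (λ w∈ → x∈p∧x∉q⇒x∈p─q (e⊆V (w∈e w∈)) (w∉M w∈))
    where
    e⊆V : e ⊆ V D
    e⊆V = All.lookup (WF.E-⊆V (Sub.wf sub)) e∈
    y∉e : y ∉ e
    y∉e = y∉D ∘ e⊆V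
    w∈e : ∀ {w} → w ∈ e ─ M (round H x y) → w ∈ e
    w∈e = proj₁ ∘ x∈p─q⁻
    w∉M : ∀ {w} → w ∈ e ─ M (round H x y) → w ∉ M (mark D x)
    w∉M w∈ with ∈-edge-free-round⁻ {H = H} y∉e w∈
    ... | w∈e─M , w≢x = x∉p∪⁅y⁆⁺ (proj₂ (x∈p─q⁻ w∈e─M) ∘ Sub⇒M⊆ sub) w≢x

delete-wf : WF H → x ∈ V H → x ≢ y → WF (delete H y)
delete-wf {H = H} wf x∈ x≢y = record
  { V-nonempty = _ , x∈p∧x≢y⇒x∈p-y x∈ x≢y
  ; E-nonempty = All.tabulate (All.lookup E-nonempty ∘ proj₁ ∘ ∈-edges-delete⁻ H)
  ; E-⊆V = All.tabulate λ e∈ → let e∈H , y∉e = ∈-edges-delete⁻ H e∈ in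
      λ w∈e → x∈p∧x≢y⇒x∈p-y (All.lookup E-⊆V e∈H w∈e) (x∈p∧y∉p⇒x≢y w∈e y∉e)
  ; M-⊆V = λ w∈ → let w∈M , w≢y = x∈p-y⁻ w∈ in x∈p∧x≢y⇒x∈p-y (M-⊆V w∈M) w≢y
  }
  where open WF wf

delete-sub : WF H → x ∈ V H → x ≢ y → Sub (delete H y) H
delete-sub {H = H} wf x∈ x≢y = record
  { wf  = delete-wf wf x∈ x≢y
  ; V⊆  = proj₁ ∘ x∈p-y⁻
  ; E⊆  = All.tabulate (proj₁ ∘ ∈-edges-delete⁻ H)
  ; Meq = p⊆q⇒p-y≡q-y∩p (WF.M-⊆V wf)
  }

mark-delete≡round : x ≢ y → mark (delete H y) x ≡ round H x y
mark-delete≡round {y = y} {H = H} x≢y =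
  cong (mhg (V H - y) (E (delete H y))) (p-y∪⁅x⁆≡p∪⁅x⁆-y x≢y)

round-win⇒delete-danger : WF H → x ∈ Free H → y ≢ x → MakerWin (round H x y) →
                          Danger H x (delete H y)
round-win⇒delete-danger {H = H} {x = x} wf x∈ y≢x win = record
  { sub = delete-sub wf x∈V (y≢x ∘ sym)
  ; x∈D = x∈p∧x≢y⇒x∈p-y x∈V (y≢x ∘ sym)
  ; win = subst MakerWin (sym (mark-delete≡round {H = H} (y≢x ∘ sym))) win
  }
  where
  x∈V : x ∈ V H
  x∈V = proj₁ (x∈p─q⁻ x∈)

mainTheorem9 : {n : ℕ} (H : MHG n) → WF H → ∣ Free H ∣ ≥ 2 →
    (BreakerWin H ⇔ ((x : Fin n) → x ∈ Free H → ∃ λ y → InInt H x y))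
mainTheorem9 {n} H wf 2≤∣free∣ = mk⇔ intersection-nonempty breakerWin
  where
  intersection-nonempty : BreakerWin H → (x : Fin n) → x ∈ Free H → ∃ λ y → InInt H x y
  intersection-nonempty lose x x∈ with breakerReply {H = H} (lose ∘ step 2≤∣free∣ x x∈)
  ... | y , y∈ , y≢x , breakerWins with x∈p─q⁻ y∈
  ...   | y∈V , y∉M = y , y∈V , y∉M , y≢x , λ D danger →
    decidable-stable (y ∈? V D) λ y∉D →
      breakerWins (makerWin-mono (danger-≼ {H = H} danger y∉D) (Danger.win danger))
  breakerWin : ((x : Fin n) → x ∈ Free H → ∃ λ y → InInt H x y) → BreakerWin H
  breakerWin _ (base ≤1 _) = <⇒≱ 2≤∣free∣ ≤1
  breakerWin int (step _ x x∈ wins) with int x x∈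
  ... | y , y∈V , y∉M , y≢x , y∈dangers =
    proj₂ (x∈p-y⁻ (y∈dangers (delete H y) danger)) refl
    where
    danger : Danger H x (delete H y)
    danger = round-win⇒delete-danger wf x∈ y≢x (wins y (x∈p∧x∉q⇒x∈p─q y∈V y∉M) y≢x)
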